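{- If an append operation in MMB has a merge step, then (in the resulting structure) the new merge peak sits at the right end of its range. Moreover, its range is either the rightmost or the second rightmost range.
   Context: A mountain of height $s\ge0$ is a perfect binary tree with $2^s$ leaves; its root is its peak. The U-MMB with $n$ leaves is an ordered (left-to-right) list of mountains whose leaves read left to right are $h_1,\dots,h_n$, built inductively from the empty list: the $n$-th append (1) adds $h_n$ as a height-0 mountain at the right end, and (2, merge step) if there exist two consecutive mountains of equal height, takes the rightmost such pair, of height $s$, and replaces it in place by a mountain of height $s+1$ whose new peak (the merge peak) has the two old peaks as children. MMB partitions the mountain list into ranges (maximal blocks of consecutive mountains): consecutive mountains $M,M'$ ($M$ immediately left of $M'$) lie in different ranges iff their heights differ by 2, or the mountain immediately left of $M$ exists and has the same height as $M$. (Within each range peaks are forward-bagged into range nodes, and range roots are forward-bagged into belt nodes.) -}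

module Defs where

open import Data.Nat using (ℕ; zero; suc; _+_; _≡ᵇ_)
open import Data.Bool using (if_then_else_)
open import Data.List using (List; []; _∷_; _++_; [_])
open import Data.Maybe using (Maybe; just; nothing)
open import Data.Product using (_×_; _,_; proj₁; proj₂; ∃)
open import Data.Sum using (_⊎_)
open import Relation.Binary.PropositionalEquality using (_≡_)

-- A U-MMB mountain list, recorded left to right by the heights of its
-- mountains (a mountain of height s is the perfect binary tree with 2^s
-- leaves; the shape of the list, the merge steps and the ranges depend only
-- on these heights).  Positions are 0-based from the left.
Mountains : Set
Mountains = List ℕ

at : Mountains → ℕ → Maybe ℕ
at []       _       = nothing
at (x ∷ _)  zero    = just x
at (_ ∷ xs) (suc k) = at xs k

rightmostPair : Mountains → Maybe ℕ
rightmostPair []            = nothing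
rightmostPair (x ∷ [])      = nothing
rightmostPair (x ∷ y ∷ ys) with rightmostPair (y ∷ ys)
... | just i  = just (suc i)
... | nothing = if x ≡ᵇ y then just zero else nothing

mergeAt : ℕ → Mountains → Mountains
mergeAt zero    (x ∷ y ∷ ys) = suc x ∷ ys
mergeAt zero    xs           = xs
mergeAt (suc i) []           = []
mergeAt (suc i) (x ∷ xs)     = x ∷ mergeAt i xs

appendStep : Mountains → Mountains × Maybe ℕ
appendStep ms with rightmostPair (ms ++ [ 0 ])
... | nothing = (ms ++ [ 0 ]) , nothing
... | just i  = mergeAt i (ms ++ [ 0 ]) , just i

umm : ℕ → Mountains
umm zero    = []
umm (suc n) = proj₁ (appendStep (umm n))

Boundary : Mountains → ℕ → Set
Boundary ms k =
  ∃ λ a → ∃ λ b → at ms k ≡ just a × at ms (suc k) ≡ just b ×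
    (a ≡ b + 2 ⊎ b ≡ a + 2 ⊎ (∃ λ k′ → k ≡ suc k′ × at ms k′ ≡ just a))

{-# OPTIONS --safe #-}
module Submission where

-- Every U-MMB is stepped: a mountain with d mountains to its right has height
-- d or d + 1.  So before an append the list is either the staircase
-- [L, …, 1], which takes the new 0 without merging, or p ++ r ∷ [r, …, 1]
-- with r the rightmost mountain of height d.  Appending 0 makes r, r the
-- rightmost equal pair and the merge gives p ++ (r + 1) ∷ [r - 1, …, 0], which
-- is stepped again.  There the merge peak is followed by a drop of 2 (a range
-- boundary) or by nothing, and from then on heights fall by exactly 1, which
-- is never a boundary.

open import Defs
open import Data.Bool using (if_then_else_)
open import Data.Empty using (⊥)
open import Data.List using (length; []; _∷_; _++_; [_]; downFrom; applyDownFrom)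
open import Data.List.Properties
  using (++-assoc; length-++; length-downFrom; length-applyDownFrom; downFrom-∷ʳ)
open import Data.Maybe using (just; nothing)
open import Data.Nat using (ℕ; zero; suc; _+_; _≤_; _<_; s≤s)
open import Data.Nat.Properties using (_≟_; 1+n≢n; m≢1+m+n; +-comm; ≤-<-trans)
open import Data.Product using (_×_; _,_; proj₁; proj₂)
open import Data.Sum using (_⊎_; inj₁; inj₂)
open import Function using (_∘_)
open import Relation.Nullary using (¬_)
open import Relation.Nullary.Decidable using (dec-true; dec-false)
open import Relation.Binary.PropositionalEquality
  using (_≡_; _≢_; refl; sym; trans; cong; subst)

data Stepped : Mountains → Set where
  []  : Stepped []
  _∷_ : ∀ {x xs} → x ≡ length xs ⊎ x ≡ suc (length xs) → Stepped xs → Stepped (x ∷ xs)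

Stepped-downFrom : ∀ n → Stepped (downFrom n)
Stepped-downFrom zero    = []
Stepped-downFrom (suc n) = inj₁ (sym (length-downFrom n)) ∷ Stepped-downFrom n

Stepped-++ : ∀ p {ys zs} → length ys ≡ length zs → Stepped zs →
             Stepped (p ++ ys) → Stepped (p ++ zs)
Stepped-++ []      _     szs _       = szs
Stepped-++ (x ∷ p) {ys} {zs} ys≡zs szs (h ∷ s) =
  subst (λ L → x ≡ L ⊎ x ≡ suc L) p++ys≡p++zs h ∷ Stepped-++ p ys≡zs szs s
  where
  p++ys≡p++zs : length (p ++ ys) ≡ length (p ++ zs)
  p++ys≡p++zs = trans (length-++ p) (trans (cong (length p +_) ys≡zs) (sym (length-++ p)))

data Shape : Mountains → Set where
  staircase : ∀ L → Shape (applyDownFrom suc L)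
  merging   : ∀ p r → Shape (p ++ r ∷ applyDownFrom suc r)

shape : ∀ {ms} → Stepped ms → Shape ms
shape []                   = staircase 0
shape (_∷_ {x} h s) with shape s
... | merging p r = merging (x ∷ p) r
... | staircase L rewrite length-applyDownFrom suc L with h
...   | inj₁ refl = merging [] L
...   | inj₂ refl = staircase (suc L)

-- dec-true and dec-false decide the test in rightmostPair:
-- does (m ≟ n) unfolds to m ≡ᵇ n.
rightmostPair-downFrom : ∀ n → rightmostPair (downFrom n) ≡ nothing
rightmostPair-downFrom zero          = refl
rightmostPair-downFrom (suc zero)    = refl
rightmostPair-downFrom (suc (suc n)) rewrite rightmostPair-downFrom (suc n) =
  cong (λ b → if b then just 0 else nothing) (dec-false (suc n ≟ n) 1+n≢n)

rightmostPair-∷ : ∀ x zs {i} → rightmostPair zs ≡ just i → rightmostPair (x ∷ zs) ≡ just (suc i)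
rightmostPair-∷ x (y ∷ ys) eq rewrite eq = refl

rightmostPair-merging : ∀ p r → rightmostPair (p ++ r ∷ downFrom (suc r)) ≡ just (length p)
rightmostPair-merging []      r rewrite rightmostPair-downFrom (suc r) =
  cong (λ b → if b then just 0 else nothing) (dec-true (r ≟ r) refl)
rightmostPair-merging (x ∷ p) r =
  rightmostPair-∷ x (p ++ r ∷ downFrom (suc r)) (rightmostPair-merging p r)

mergeAt-++ : ∀ p x y ys → mergeAt (length p) (p ++ x ∷ y ∷ ys) ≡ p ++ suc x ∷ ys
mergeAt-++ []      x y ys = refl
mergeAt-++ (z ∷ p) x y ys = cong (z ∷_) (mergeAt-++ p x y ys)

appendStep-noMerge : ∀ {ms zs} → ms ++ [ 0 ] ≡ zs → rightmostPair zs ≡ nothing →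
                     appendStep ms ≡ (zs , nothing)
appendStep-noMerge refl eq rewrite eq = refl

appendStep-merge : ∀ {ms zs i} → ms ++ [ 0 ] ≡ zs → rightmostPair zs ≡ just i →
                   appendStep ms ≡ (mergeAt i zs , just i)
appendStep-merge refl eq rewrite eq = refl

appendStep-staircase : ∀ L → appendStep (applyDownFrom suc L) ≡ (downFrom (suc L) , nothing)
appendStep-staircase L = appendStep-noMerge (downFrom-∷ʳ L) (rightmostPair-downFrom (suc L))

appendStep-merging : ∀ p r →
  appendStep (p ++ r ∷ applyDownFrom suc r) ≡ (p ++ suc r ∷ downFrom r , just (length p))
appendStep-merging p r =
  trans (appendStep-merge merging-∷ʳ (rightmostPair-merging p r))
        (cong (_, just (length p)) (mergeAt-++ p r r (downFrom r)))
  where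
  merging-∷ʳ : (p ++ r ∷ applyDownFrom suc r) ++ [ 0 ] ≡ p ++ r ∷ downFrom (suc r)
  merging-∷ʳ = trans (++-assoc p _ [ 0 ]) (cong (λ zs → p ++ r ∷ zs) (downFrom-∷ʳ r))

Stepped-appendStep : ∀ {ms} → Stepped ms → Stepped (proj₁ (appendStep ms))
Stepped-appendStep s with shape s
... | staircase L rewrite appendStep-staircase L = Stepped-downFrom (suc L)
... | merging p r rewrite appendStep-merging p r =
  Stepped-++ p (cong suc (trans (length-applyDownFrom suc r) (sym (length-downFrom r))))
               peak∷downFrom s
  where
  peak∷downFrom : Stepped (suc r ∷ downFrom r)
  peak∷downFrom = inj₂ (cong suc (sym (length-downFrom r))) ∷ Stepped-downFrom r

Stepped-umm : ∀ n → Stepped (umm n)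
Stepped-umm zero    = []
Stepped-umm (suc n) = Stepped-appendStep (Stepped-umm n)

Boundary-∷⁺ : ∀ {x ms k} → Boundary ms k → Boundary (x ∷ ms) (suc k)
Boundary-∷⁺ (a , b , ea , eb , inj₁ d)        = a , b , ea , eb , inj₁ d
Boundary-∷⁺ (a , b , ea , eb , inj₂ (inj₁ d)) = a , b , ea , eb , inj₂ (inj₁ d)
Boundary-∷⁺ (a , b , ea , eb , inj₂ (inj₂ (k′ , refl , ek))) =
  a , b , ea , eb , inj₂ (inj₂ (suc k′ , refl , ek))

Boundary-∷⁻ : ∀ {x ms k} → Boundary (x ∷ ms) (suc (suc k)) → Boundary ms (suc k)
Boundary-∷⁻ (a , b , ea , eb , inj₁ d)        = a , b , ea , eb , inj₁ d
Boundary-∷⁻ (a , b , ea , eb , inj₂ (inj₁ d)) = a , b , ea , eb , inj₂ (inj₁ d)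
Boundary-∷⁻ (a , b , ea , eb , inj₂ (inj₂ (_ , refl , ek))) =
  a , b , ea , eb , inj₂ (inj₂ (_ , refl , ek))

¬Boundary-unitDescent : ∀ ms {k h} → at ms (suc k) ≡ just (suc h) →
                        at ms (suc (suc k)) ≡ just h → at ms k ≢ just (suc h) →
                        ¬ Boundary ms (suc k)
¬Boundary-unitDescent _ ea eb ¬ec (a , b , ea′ , eb′ , d)
  with refl ← trans (sym ea) ea′ | refl ← trans (sym eb) eb′ with d
... | inj₁ 1+b≡b+2                = 1+n≢n (sym (trans 1+b≡b+2 (+-comm b 2)))
... | inj₂ (inj₁ b≡1+b+2)         = m≢1+m+n b b≡1+b+2
... | inj₂ (inj₂ (_ , refl , ec)) = ¬ec ec

¬Boundary-downFrom : ∀ r t → ¬ Boundary (downFrom r) (suc t)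
¬Boundary-downFrom zero                _       (_ , _ , () , _)
¬Boundary-downFrom (suc r)             (suc t) = ¬Boundary-downFrom r t ∘ Boundary-∷⁻
¬Boundary-downFrom (suc zero)          zero    (_ , _ , () , _)
¬Boundary-downFrom (suc (suc zero))    zero    (_ , _ , _ , () , _)
¬Boundary-downFrom (suc (suc (suc r))) zero    =
  ¬Boundary-unitDescent (downFrom (3 + r)) refl refl λ ()

¬Boundary-afterPeak : ∀ p r {k} → length p < k → ¬ Boundary (p ++ suc r ∷ downFrom r) k
¬Boundary-afterPeak []      r             {suc (suc t)} _ = ¬Boundary-downFrom r t ∘ Boundary-∷⁻
¬Boundary-afterPeak []      zero          {suc zero}    _ (_ , _ , () , _)
¬Boundary-afterPeak []      (suc zero)    {suc zero}    _ (_ , _ , _ , () , _)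
¬Boundary-afterPeak []      (suc (suc r)) {suc zero}    _ =
  ¬Boundary-unitDescent (3 + r ∷ downFrom (2 + r)) refl refl λ ()
¬Boundary-afterPeak (x ∷ p) r             {suc (suc k)} (s≤s p<1+k) =
  ¬Boundary-afterPeak p r p<1+k ∘ Boundary-∷⁻

EndsRange : Mountains → ℕ → Set
EndsRange ms i = suc i ≡ length ms ⊎ Boundary ms i

peak-EndsRange : ∀ p r → EndsRange (p ++ suc r ∷ downFrom r) (length p)
peak-EndsRange []      zero    = inj₁ refl
peak-EndsRange []      (suc r) = inj₂ (suc (suc r) , r , refl , refl , inj₁ (+-comm 2 r))
peak-EndsRange (x ∷ p) r with peak-EndsRange p r
... | inj₁ end = inj₁ (cong suc end)
... | inj₂ bd  = inj₂ (Boundary-∷⁺ bd)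

AtMostOneBoundaryFrom : Mountains → ℕ → Set
AtMostOneBoundaryFrom ms i = (j k : ℕ) → i ≤ j → j < k → Boundary ms j → Boundary ms k → ⊥

peak-inLastTwoRanges : ∀ p r → let ms = p ++ suc r ∷ downFrom r in
                       EndsRange ms (length p) × AtMostOneBoundaryFrom ms (length p)
peak-inLastTwoRanges p r =
  peak-EndsRange p r , λ _ _ p≤j j<k _ → ¬Boundary-afterPeak p r (≤-<-trans p≤j j<k)

appendStep-mergePeak : ∀ {ms i} → Stepped ms → proj₂ (appendStep ms) ≡ just i →
                       let ms′ = proj₁ (appendStep ms) in
                       EndsRange ms′ i × AtMostOneBoundaryFrom ms′ i
appendStep-mergePeak s merged with shape s
... | staircase L rewrite appendStep-staircase L with () ← merged
... | merging p r rewrite appendStep-merging p r with refl ← merged = peak-inLastTwoRanges p r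

lemma13 : (n i : ℕ) → proj₂ (appendStep (umm n)) ≡ just i →
    (suc i ≡ length (umm (suc n)) ⊎ Boundary (umm (suc n)) i) ×
    ((j k : ℕ) → i ≤ j → j < k → Boundary (umm (suc n)) j → Boundary (umm (suc n)) k → ⊥)
lemma13 n i = appendStep-mergePeak (Stepped-umm n)
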